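{- Let $\ell,\ell'\in\mathcal{L}$ with $\neg(\ell\le\ell')$. Then there is no natural transformation from the functor $T_\ell$ to the functor $T_{\ell'}$ (both endofunctors of $\mathcal{G}_{\mathcal{L}}$).
   Context: Security semilattice: $(\mathcal{L},\sqcup,\bot)$ with $\ell\le\ell'$ iff $\ell\sqcup\ell'=\ell'$. A game $A=(M_A,\lambda_A,\mathsf{j}_A,P_A,\approx_A,\mathsf{lev}_A)$: moves $M_A$; labelling $\lambda_A:M_A\to\{P,O\}\times\{Q,A\}$; partial justification $\mathsf{j}_A:M_A\rightharpoonup M_A$ (well-founded; P-moves justified by O-moves and vice versa; answers justified by questions; moves with no justifier are initial, forming $\mathsf{Init}_A$); levels $\mathsf{lev}_A:M_A\to\mathcal{L}$; a non-empty prefix-closed set $P_A$ of finite move sequences which start with an O-move, alternate O/P, contain each move at most once, are prefixes of well-bracketed strings (answers close their justifying questions), contain the justifier of each move earlier, and satisfy $\mathsf{lev}_A(m)\le\mathsf{lev}_A(\mathsf{j}_A(m))$ for each non-initial move $m$; an equivalence $\approx_A$ on $P_A$ preserving label sequences, closed under equal-length prefixes, and such that $s\approx_A t$, $sa\in P_A$ imply $sa\approx_A tb$ for some $b$. $A\multimap B$: moves $(\mathsf{Init}_B\times M_A)+M_B$, O/P swapped on $A$, an initial $A$-move in copy $b\in\mathsf{Init}_B$ is justified by $b$, other justification and levels componentwise; plays are legal sequences (all conditions above) restricting to plays of $A$ (tags forgotten) and of $B$; equivalence componentwise per copy plus equal pattern of components. A strategy on $A$: non-empty set $\sigma$ of even-length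 plays, closed under even-length prefixes, closed under $\approx_A$, and such that $sab,ta'b'\in\sigma$, $sa\approx_A ta'$ imply $sab\approx_A ta'b'$. $\mathcal{G}_{\mathcal{L}}$: objects games, morphisms $A\to B$ strategies on $A\multimap B$, identities copy-cat strategies $\{s\mid s\restriction 1\approx_A s\restriction 2\}$, composition $\sigma;\tau=\{s\restriction A,C\mid s\restriction A,B\in\sigma, s\restriction B,C\in\tau\}$. For $\ell\in\mathcal{L}$, $T_\ell A$ is the game $A$ with only the level map changed to $\mathsf{lev}_{T_\ell A}(m)=\mathsf{lev}_A(m)\sqcup\ell$; on morphisms, $T_\ell\sigma=\sigma$ (a strategy $A\multimap B$ is also a strategy on $T_\ell A\multimap T_\ell B$, which has the same plays). -}

module Defs where

open import Level using (Level; _⊔_) renaming (suc to lsuc; zero to lzero)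
open import Algebra.Lattice.Bundles using (BoundedJoinSemilattice)
open import Data.Bool using (T)
open import Data.Empty using (⊥)
open import Data.Unit using (⊤)
open import Data.Nat using (ℕ; zero; suc)
open import Data.Nat.Divisibility using (_∣_)
open import Data.Maybe using (Maybe; just; nothing; is-nothing)
import Data.Maybe
open import Data.Product using (Σ; ∃; _×_; _,_; proj₁; proj₂)
open import Data.Sum using (_⊎_; inj₁; inj₂)
open import Data.List using (List; []; _∷_; _++_; _∷ʳ_; map; length; mapMaybe)
open import Data.List.Membership.Propositional using (_∈_)
open import Data.List.Relation.Unary.All using (All)
open import Data.List.Relation.Unary.Unique.Propositional using (Unique)
open import Induction.WellFounded using (WellFounded)
open import Relation.Binary.PropositionalEquality using (_≡_; _≢_)
open import Relation.Nullary using (¬_)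

data Player : Set where
  P O : Player

data Kind : Set where
  Q A : Kind

opp : Player → Player
opp P = O
opp O = P

At : ∀ {X : Set} → List X → ℕ → X → Set
At []      _       _ = ⊥
At (y ∷ s) zero    x = y ≡ x
At (y ∷ s) (suc i) x = At s i x

module Games {c r : Level} (L : BoundedJoinSemilattice c r) where

  open BoundedJoinSemilattice L
    renaming (Carrier to Lev; _≈_ to _≈L_; _∨_ to _⊔L_; ⊥ to ⊥L)

  _≤_ : Lev → Lev → Set r
  ℓ ≤ ℓ' = (ℓ ⊔L ℓ') ≈L ℓ'

  record Arena : Set (lsuc lzero ⊔ c) where
    field
      M   : Set
      lab : M → Player × Kind
      j   : M → Maybe M
      lev : M → Lev

    pl : M → Player
    pl m = proj₁ (lab m)

    kind : M → Kind
    kind m = proj₂ (lab m)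

    IsInit : M → Set
    IsInit m = T (is-nothing (j m))

    Init : Set
    Init = Σ M IsInit

    AltFrom : Player → List M → Set
    AltFrom p []      = ⊤
    AltFrom p (m ∷ s) = (pl m ≡ p) × AltFrom (opp p) s

    JustEarlier : List M → List M → Set
    JustEarlier seen []      = ⊤
    JustEarlier seen (m ∷ s) =
      (∀ n → j m ≡ just n → n ∈ seen) × JustEarlier (m ∷ seen) s

    LevOK : List M → Set r
    LevOK s = All (λ m → ∀ n → j m ≡ just n → lev m ≤ lev n) s

    -- prefix of a well-bracketed string: every answer is justified by,
    -- and closes, the most recent pending question
    -- (first argument: stack of pending questions)
    mutual
      WB : List M → List M → Set
      WB st []      = ⊤
      WB st (m ∷ s) = WBstep (kind m) st m s

      WBstep : Kind → List M → M → List M → Set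
      WBstep Q st       m s = WB (m ∷ st) s
      WBstep A []       m s = ⊥
      WBstep A (q ∷ st) m s = (j m ≡ just q) × WB st s

    Legal : List M → Set r
    Legal s = AltFrom O s × Unique s × JustEarlier [] s × LevOK s × WB [] s

  record GameData : Set (lsuc lzero ⊔ c ⊔ lsuc r) where
    field
      arena : Arena
    open Arena arena public
    field
      Plays : List M → Set r
      _≋_   : List M → List M → Set r

  record IsGame (G : GameData) : Set (lsuc lzero ⊔ c ⊔ lsuc r) where
    open GameData G
    field
      j-wf       : WellFounded (λ n m → j m ≡ just n)
      j-polarity : ∀ m n → j m ≡ just n → pl n ≡ opp (pl m)
      j-answer   : ∀ m n → j m ≡ just n → kind m ≡ A → kind n ≡ Q
      plays-nonempty : ∃ Plays
      plays-prefix   : ∀ s t → Plays (s ++ t) → Plays s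
      plays-legal    : ∀ s → Plays s → Legal s
      ≋-plays  : ∀ s t → s ≋ t → Plays s × Plays t
      ≋-refl   : ∀ s → Plays s → s ≋ s
      ≋-sym    : ∀ s t → s ≋ t → t ≋ s
      ≋-trans  : ∀ s t u → s ≋ t → t ≋ u → s ≋ u
      ≋-labels : ∀ s t → s ≋ t → map lab s ≡ map lab t
      ≋-prefix : ∀ s s' t t' → (s ++ s') ≋ (t ++ t') → length s ≡ length t → s ≋ t
      ≋-extend : ∀ s t a → s ≋ t → Plays (s ∷ʳ a) → ∃ λ b → (s ∷ʳ a) ≋ (t ∷ʳ b)

  record Game : Set (lsuc lzero ⊔ c ⊔ lsuc r) where
    field
      gd     : GameData
      isGame : IsGame gd

  restL : ∀ {X Y Z : Set} → List ((X × Y) ⊎ Z) → List Y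
  restL = mapMaybe λ { (inj₁ (_ , a)) → just a ; (inj₂ _) → nothing }

  restR : ∀ {W Z : Set} → List (W ⊎ Z) → List Z
  restR = mapMaybe λ { (inj₁ _) → nothing ; (inj₂ m) → just m }

  data CopyRestr {X Y Z : Set} {IX : X → Set} (x : X) :
         List ((Σ X IX × Y) ⊎ Z) → List Y → Set where
    cr-nil  : CopyRestr x [] []
    cr-keep : ∀ {b a s u} → proj₁ b ≡ x → CopyRestr x s u →
              CopyRestr x (inj₁ (b , a) ∷ s) (a ∷ u)
    cr-skip : ∀ {b a s u} → proj₁ b ≢ x → CopyRestr x s u →
              CopyRestr x (inj₁ (b , a) ∷ s) u
    cr-right : ∀ {m s u} → CopyRestr x s u → CopyRestr x (inj₂ m ∷ s) u

  module _ (GA GB : GameData) where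
    private
      module A = GameData GA
      module B = GameData GB

    Mv⊸ : Set
    Mv⊸ = (B.Init × A.M) ⊎ B.M

    lab⊸ : Mv⊸ → Player × Kind
    lab⊸ (inj₁ (_ , a)) = opp (A.pl a) , A.kind a
    lab⊸ (inj₂ m)       = B.lab m

    jcopy : B.Init → Maybe A.M → Maybe Mv⊸
    jcopy b nothing  = just (inj₂ (proj₁ b))
    jcopy b (just n) = just (inj₁ (b , n))

    j⊸ : Mv⊸ → Maybe Mv⊸
    j⊸ (inj₁ (b , a)) = jcopy b (A.j a)
    j⊸ (inj₂ m)       = Data.Maybe.map inj₂ (B.j m)

    lev⊸ : Mv⊸ → Lev
    lev⊸ (inj₁ (_ , a)) = A.lev a
    lev⊸ (inj₂ m)       = B.lev m

    arena⊸ : Arena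
    arena⊸ = record { M = Mv⊸ ; lab = lab⊸ ; j = j⊸ ; lev = lev⊸ }

    Plays⊸ : List Mv⊸ → Set r
    Plays⊸ s = Arena.Legal arena⊸ s × A.Plays (restL s) × B.Plays (restR s)

    -- the component pattern: which positions are B-moves, and which
    -- A-moves lie in the copy opened at which position
    IsRight : List Mv⊸ → ℕ → Set
    IsRight s i = ∃ λ m → At s i (inj₂ m)

    InCopy : List Mv⊸ → ℕ → ℕ → Set
    InCopy s i k = ∃ λ b → ∃ λ a → At s i (inj₁ (b , a)) × At s k (inj₂ (proj₁ b))

    SamePattern : List Mv⊸ → List Mv⊸ → Set
    SamePattern s t =
      length s ≡ length t ×
      (∀ i → (IsRight s i → IsRight t i) × (IsRight t i → IsRight s i)) ×
      (∀ i k → (InCopy s i k → InCopy t i k) × (InCopy t i k → InCopy s i k))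

    PerCopy : List Mv⊸ → List Mv⊸ → Set r
    PerCopy s t = ∀ k (b b' : B.Init) →
      At s k (inj₂ (proj₁ b)) → At t k (inj₂ (proj₁ b')) →
      ∀ u u' → CopyRestr (proj₁ b) s u → CopyRestr (proj₁ b') t u' → u A.≋ u'

    _≋⊸_ : List Mv⊸ → List Mv⊸ → Set r
    s ≋⊸ t = Plays⊸ s × Plays⊸ t × SamePattern s t ×
             (restR s B.≋ restR t) × PerCopy s t

  _⊸_ : GameData → GameData → GameData
  GA ⊸ GB = record
    { arena = arena⊸ GA GB
    ; Plays = Plays⊸ GA GB
    ; _≋_   = _≋⊸_ GA GB
    }

  Even : ℕ → Set
  Even n = 2 ∣ n

  record Strategy (G : GameData) : Set (lsuc lzero ⊔ r) where
    open GameData G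
    field
      σ          : List M → Set
      nonempty   : ∃ σ
      plays      : ∀ s → σ s → Plays s × Even (length s)
      prefix     : ∀ s t → σ (s ++ t) → Even (length s) → σ s
      ≋-closed   : ∀ s t → σ s → s ≋ t → σ t
      determined : ∀ s t a b a' b' → σ (s ++ a ∷ b ∷ []) → σ (t ++ a' ∷ b' ∷ []) →
                   (s ∷ʳ a) ≋ (t ∷ʳ a') → (s ++ a ∷ b ∷ []) ≋ (t ++ a' ∷ b' ∷ [])
  open Strategy public using (σ)

  module _ (X Y Z : GameData) where
    private
      module X = GameData X
      module Y = GameData Y
      module Z = GameData Z

    -- moves of the interaction: A-moves tagged by a C-copy and a B-copy,
    -- B-moves tagged by a C-copy, C-moves
    IMv : Set
    IMv = (Z.Init × Y.Init × X.M) ⊎ ((Z.Init × Y.M) ⊎ Z.M)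

    toXY : IMv → Maybe (Mv⊸ X Y)
    toXY (inj₁ (_ , y , x))  = just (inj₁ (y , x))
    toXY (inj₂ (inj₁ (_ , m))) = just (inj₂ m)
    toXY (inj₂ (inj₂ _))       = nothing

    toYZ : IMv → Maybe (Mv⊸ Y Z)
    toYZ (inj₁ _)              = nothing
    toYZ (inj₂ (inj₁ (z , m))) = just (inj₁ (z , m))
    toYZ (inj₂ (inj₂ m))       = just (inj₂ m)

    toXZ : IMv → Maybe (Mv⊸ X Z)
    toXZ (inj₁ (z , _ , x))  = just (inj₁ (z , x))
    toXZ (inj₂ (inj₁ _))     = nothing
    toXZ (inj₂ (inj₂ m))     = just (inj₂ m)

    compose : (List (Mv⊸ X Y) → Set) → (List (Mv⊸ Y Z) → Set) →
              List (Mv⊸ X Z) → Set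
    compose σ τ t = ∃ λ (s : List IMv) →
      (mapMaybe toXZ s ≡ t) × σ (mapMaybe toXY s) × τ (mapMaybe toYZ s)

  _≐_ : ∀ {X : Set} → (List X → Set) → (List X → Set) → Set
  S ≐ S' = ∀ t → (S t → S' t) × (S' t → S t)

  -- The functor T_ℓ: only the levels change; on morphisms T_ℓ σ = σ

  Tarena : Lev → Arena → Arena
  Tarena ℓ Ar = record
    { M = Arena.M Ar ; lab = Arena.lab Ar ; j = Arena.j Ar
    ; lev = λ m → Arena.lev Ar m ⊔L ℓ }

  TL : Lev → GameData → GameData
  TL ℓ G = record
    { arena = Tarena ℓ (GameData.arena G)
    ; Plays = GameData.Plays G
    ; _≋_   = GameData._≋_ G }

  record NatTrans (ℓ ℓ' : Lev) : Set (lsuc lzero ⊔ c ⊔ lsuc r) where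
    field
      η : (G : Game) → Strategy (TL ℓ (Game.gd G) ⊸ TL ℓ' (Game.gd G))
      natural : (G H : Game) (s : Strategy (Game.gd G ⊸ Game.gd H)) →
        compose (TL ℓ (Game.gd G)) (TL ℓ (Game.gd H)) (TL ℓ' (Game.gd H))
                (σ s) (σ (η H))
        ≐
        compose (TL ℓ (Game.gd G)) (TL ℓ' (Game.gd G)) (TL ℓ' (Game.gd H))
                (σ (η G)) (σ s)

-- Let 𝟘 be the empty game and com the game with a single question q
-- and its answer a (both at level ⊥). There are two strategies 𝟘 ⊸ com: Ω, which
-- never answers, and skip, which answers q by a. The play "q a" lies in
-- η_𝟘 ; T_ℓ' skip, hence by naturality in T_ℓ skip ; η_com, through an interaction
-- whose skip-part is [] or "q a". If it is [], the same interaction lies in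
-- T_ℓ Ω ; η_com, and naturality puts "q a" into η_𝟘 ; T_ℓ' Ω, impossible since Ω
-- plays no move of com. Otherwise η_com plays q in its domain T_ℓ com, justified
-- by the initial q of its codomain T_ℓ' com; the level condition on plays then
-- reads ⊥ ⊔ ℓ ≤ ⊥ ⊔ ℓ', i.e. ℓ ≤ ℓ'.
module Submission where

open import Defs
open import Algebra.Lattice.Bundles using (BoundedJoinSemilattice)
open import Relation.Nullary using (¬_)
open import Function using (case_of_; id)
open import Level using (Lift; lift; lower)
open import Data.Empty using (⊥-elim) renaming (⊥ to Empty)
open import Data.Unit using (tt)
open import Data.Nat.Properties using (suc-injective)
open import Data.Nat.Divisibility using (_∣0; ∣-refl; ∣1⇒≡1)
open import Data.Maybe using (nothing; just)
open import Data.Product using (∃; _×_; _,_; proj₁; proj₂)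
open import Data.Sum using (inj₁; inj₂)
open import Data.List using (List; []; _∷_; _++_; _∷ʳ_; length; mapMaybe)
open import Data.List.Properties using (∷-injective; ++-conicalˡ; ++-conicalʳ)
open import Data.List.Membership.Propositional using (_∈_)
open import Data.List.Relation.Unary.Any using (here; there)
open import Data.List.Relation.Unary.All using ([]; _∷_) renaming (lookup to All-lookup)
open import Data.List.Relation.Unary.AllPairs using ([]; _∷_)
open import Induction.WellFounded using (WellFounded; acc)
open import Relation.Binary.PropositionalEquality
  using (_≡_; refl; sym; trans; cong; cong₂; subst)

++-injectiveˡ : ∀ {X : Set} (xs ys : List X) {xs' ys' : List X} →
                length xs ≡ length ys → xs ++ xs' ≡ ys ++ ys' → xs ≡ ys
++-injectiveˡ []       []       _   _  = refl
++-injectiveˡ (x ∷ xs) (y ∷ ys) |xs|≡|ys| eq =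
  let x≡y , rest = ∷-injective eq
  in cong₂ _∷_ x≡y (++-injectiveˡ xs ys (suc-injective |xs|≡|ys|) rest)

List-Empty-[] : (u : List Empty) → u ≡ []
List-Empty-[] [] = refl

module _ {c r} (L : BoundedJoinSemilattice c r) where

  open BoundedJoinSemilattice L using (Carrier; _≈_; _∨_; ⊥; identityˡ; ∨-cong; setoid)
  open import Relation.Binary.Reasoning.Setoid setoid
  open Games L
  open Game using (gd)

  ≤-cong : ∀ {x x' y y'} → x ≈ x' → y ≈ y' → x ≤ y → x' ≤ y'
  ≤-cong {x} {x'} {y} {y'} x≈x' y≈y' x≤y = begin
    x' ∨ y' ≈⟨ ∨-cong x≈x' y≈y' ⟨
    x ∨ y   ≈⟨ x≤y ⟩
    y       ≈⟨ y≈y' ⟩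
    y'      ∎

  []∈σ : ∀ {G} (S : Strategy G) → σ S []
  []∈σ S = let s , s∈σ = Strategy.nonempty S
           in Strategy.prefix S [] s s∈σ (2 ∣0)

  lev-initial≤lev-copy : ∀ (G H : GameData) {s b a} →
    Arena.Legal (arena⊸ G H) s → inj₁ (b , a) ∈ s → GameData.j G a ≡ nothing →
    GameData.lev G a ≤ GameData.lev H (proj₁ b)
  lev-initial≤lev-copy G H {b = b} (_ , _ , _ , levOK , _) ba∈s a-initial =
    All-lookup levOK ba∈s (inj₂ (proj₁ b)) (cong (jcopy G H b) a-initial)

  module Interaction (X Y Z : GameData) where

    _↾XY : List (IMv X Y Z) → List (Mv⊸ X Y)
    _↾XY = mapMaybe (toXY X Y Z)

    _↾YZ : List (IMv X Y Z) → List (Mv⊸ Y Z)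
    _↾YZ = mapMaybe (toYZ X Y Z)

    _↾XZ : List (IMv X Y Z) → List (Mv⊸ X Z)
    _↾XZ = mapMaybe (toXZ X Y Z)

    restR-↾XZ≡restR-↾YZ : ∀ s → restR (s ↾XZ) ≡ restR (s ↾YZ)
    restR-↾XZ≡restR-↾YZ []                   = refl
    restR-↾XZ≡restR-↾YZ (inj₁ _ ∷ s)         = restR-↾XZ≡restR-↾YZ s
    restR-↾XZ≡restR-↾YZ (inj₂ (inj₁ _) ∷ s)  = restR-↾XZ≡restR-↾YZ s
    restR-↾XZ≡restR-↾YZ (inj₂ (inj₂ m) ∷ s)  = cong (m ∷_) (restR-↾XZ≡restR-↾YZ s)

    ∈-↾XY-right : ∀ s {m} → inj₂ m ∈ s ↾XY → ∃ λ z → inj₁ (z , m) ∈ s ↾YZ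
    ∈-↾XY-right (inj₁ _ ∷ s)             (there m∈s) = ∈-↾XY-right s m∈s
    ∈-↾XY-right (inj₂ (inj₁ (z , _)) ∷ s) (here refl) = z , here refl
    ∈-↾XY-right (inj₂ (inj₁ _) ∷ s)       (there m∈s) =
      let z , zm∈s = ∈-↾XY-right s m∈s in z , there zm∈s
    ∈-↾XY-right (inj₂ (inj₂ _) ∷ s)       m∈s         =
      let z , zm∈s = ∈-↾XY-right s m∈s in z , there zm∈s

    compose-restR : ∀ {ρ τ t} → compose X Y Z ρ τ t → ∃ λ u → τ u × restR u ≡ restR t
    compose-restR (s , s↾XZ≡t , _ , s↾YZ∈τ) =
      s ↾YZ , s↾YZ∈τ , trans (sym (restR-↾XZ≡restR-↾YZ s)) (cong restR s↾XZ≡t)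

  discreteGame : (G : Arena) (Plays : List (Arena.M G) → Set) →
    WellFounded (λ n m → Arena.j G m ≡ just n) →
    (∀ m n → Arena.j G m ≡ just n → Arena.pl G n ≡ opp (Arena.pl G m)) →
    (∀ m n → Arena.j G m ≡ just n → Arena.kind G m ≡ A → Arena.kind G n ≡ Q) →
    Plays [] → (∀ s t → Plays (s ++ t) → Plays s) → (∀ s → Plays s → Arena.Legal G s) →
    Game
  discreteGame G Plays wf polarity answer []∈P prefix legal = record
    { gd = gameData
    ; isGame = record
      { j-wf = wf
      ; j-polarity = polarity
      ; j-answer = answer
      ; plays-nonempty = [] , lift []∈P
      ; plays-prefix = λ s t p → lift (prefix s t (lower p))
      ; plays-legal = λ s p → legal s (lower p)
      ; ≋-plays = λ { s .s (lift (refl , p)) → lift p , lift p }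
      ; ≋-refl = λ s p → lift (refl , lower p)
      ; ≋-sym = λ { s .s (lift (refl , p)) → lift (refl , p) }
      ; ≋-trans = λ { s .s .s (lift (refl , p)) (lift (refl , _)) → lift (refl , p) }
      ; ≋-labels = λ { s .s (lift (refl , _)) → refl }
      ; ≋-prefix = λ { s s' t t' (lift (eq , p)) |s|≡|t| →
                       lift (++-injectiveˡ s t |s|≡|t| eq , prefix s s' p) }
      ; ≋-extend = λ { s .s x (lift (refl , _)) p → x , lift (refl , lower p) }
      }
    }
    where
    gameData : GameData
    gameData = record
      { arena = G
      ; Plays = λ s → Lift r (Plays s)
      ; _≋_ = λ s t → Lift r ((s ≡ t) × Plays s)
      }

  𝟘 : Game
  𝟘 = discreteGame
    (record { M = Empty ; lab = λ () ; j = λ () ; lev = λ () })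
    (_≡ []) (λ ()) (λ ()) (λ ()) refl ++-conicalˡ
    (λ { .[] refl → tt , [] , tt , [] , tt })

  data ComMove : Set where
    q a : ComMove

  data ComPlay : List ComMove → Set where
    ε  : ComPlay []
    q· : ComPlay (q ∷ [])
    qa : ComPlay (q ∷ a ∷ [])

  com : Game
  com = discreteGame arena ComPlay wf polarity answer ε prefix legal
    where
    arena : Arena
    arena = record
      { M = ComMove
      ; lab = λ { q → O , Q ; a → P , A }
      ; j = λ { q → nothing ; a → just q }
      ; lev = λ _ → ⊥
      }
    open Arena arena using (j; pl; kind; Legal)

    wf : WellFounded (λ n m → j m ≡ just n)
    wf q = acc λ ()
    wf a = acc λ { refl → wf q }

    polarity : ∀ m n → j m ≡ just n → pl n ≡ opp (pl m)
    polarity a q refl = refl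

    answer : ∀ m n → j m ≡ just n → kind m ≡ A → kind n ≡ Q
    answer a q refl _ = refl

    prefix : ∀ s t → ComPlay (s ++ t) → ComPlay s
    prefix []            _ _  = ε
    prefix (q ∷ [])      _ _  = q·
    prefix (q ∷ a ∷ [])  _ _  = qa
    prefix (q ∷ a ∷ _ ∷ _) _ ()
    prefix (q ∷ q ∷ _)   _ ()
    prefix (a ∷ _)       _ ()

    legal : ∀ s → ComPlay s → Legal s
    legal .[] ε = tt , [] , tt , [] , tt
    legal .(q ∷ []) q· = (refl , tt) , ([] ∷ []) , ((λ _ ()) , tt) , ((λ _ ()) ∷ []) , tt
    legal .(q ∷ a ∷ []) qa =
      (refl , refl , tt) , (((λ ()) ∷ []) ∷ [] ∷ []) ,
      ((λ _ ()) , (λ { _ refl → here refl }) , tt) ,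
      ((λ _ ()) ∷ (λ { _ refl → identityˡ ⊥ }) ∷ []) , (refl , tt)

  𝟘⊸com : GameData
  𝟘⊸com = gd 𝟘 ⊸ gd com

  qa⊸ : List (Mv⊸ (gd 𝟘) (gd com))
  qa⊸ = inj₂ q ∷ inj₂ a ∷ []

  restR-injective : ∀ {H} (s t : List (Mv⊸ (gd 𝟘) H)) → restR s ≡ restR t → s ≡ t
  restR-injective (inj₁ (_ , ()) ∷ _) _ _
  restR-injective _ (inj₁ (_ , ()) ∷ _) _
  restR-injective []           []           _  = refl
  restR-injective []           (inj₂ _ ∷ _) ()
  restR-injective (inj₂ _ ∷ _) []           ()
  restR-injective {H} (inj₂ m ∷ s) (inj₂ n ∷ t) eq =
    let m≡n , rest = ∷-injective eq in cong₂ _∷_ (cong inj₂ m≡n) (restR-injective {H} s t rest)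

  ≋-𝟘⊸com⇒≡ : ∀ {s t} → GameData._≋_ 𝟘⊸com s t → s ≡ t
  ≋-𝟘⊸com⇒≡ {s} {t} (_ , _ , _ , lift (restR-s≡restR-t , _) , _) =
    restR-injective {gd com} s t restR-s≡restR-t

  []⊸-play : GameData.Plays 𝟘⊸com []
  []⊸-play = (tt , [] , tt , [] , tt) , lift refl , lift ε

  qa⊸-play : GameData.Plays 𝟘⊸com qa⊸
  qa⊸-play =
    ((refl , refl , tt) , (((λ ()) ∷ []) ∷ [] ∷ []) ,
     ((λ _ ()) , (λ { _ refl → here refl }) , tt) ,
     ((λ _ ()) ∷ (λ { _ refl → identityˡ ⊥ }) ∷ []) , (refl , tt)) ,
    lift refl , lift qa

  qa⊸-refl : GameData._≋_ 𝟘⊸com qa⊸ qa⊸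
  qa⊸-refl =
    qa⊸-play , qa⊸-play ,
    (refl , (λ _ → id , id) , (λ _ _ → id , id)) ,
    lift (refl , qa) ,
    (λ { _ _ _ _ _ u u' _ _ → lift (trans (List-Empty-[] u) (sym (List-Empty-[] u')) ,
                                    List-Empty-[] u) })

  Ω : Strategy 𝟘⊸com
  Ω = record
    { σ = _≡ []
    ; nonempty = [] , refl
    ; plays = λ { .[] refl → []⊸-play , (2 ∣0) }
    ; prefix = λ s t s++t≡[] _ → ++-conicalˡ s t s++t≡[]
    ; ≋-closed = λ _ _ s≡[] s≋t → subst (_≡ []) (≋-𝟘⊸com⇒≡ s≋t) s≡[]
    ; determined = λ s _ x y _ _ s++xy≡[] _ _ → case ++-conicalʳ s (x ∷ y ∷ []) s++xy≡[] of λ ()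
    }

  data SkipPlay : List (Mv⊸ (gd 𝟘) (gd com)) → Set where
    silent   : SkipPlay []
    answered : SkipPlay qa⊸

  nonempty-SkipPlay : ∀ u v → SkipPlay (u ++ v) → ¬ v ≡ [] → u ++ v ≡ qa⊸
  nonempty-SkipPlay u v p v≢[] with u ++ v in eq | p
  ... | .[]  | silent   = ⊥-elim (v≢[] (++-conicalʳ u v eq))
  ... | .qa⊸ | answered = refl

  skip : Strategy 𝟘⊸com
  skip = record
    { σ = SkipPlay
    ; nonempty = [] , silent
    ; plays = λ { .[] silent → []⊸-play , (2 ∣0) ; ._ answered → qa⊸-play , ∣-refl }
    ; prefix = prefix
    ; ≋-closed = λ _ _ s∈skip s≋t → subst SkipPlay (≋-𝟘⊸com⇒≡ s≋t) s∈skip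
    ; determined = determined
    }
    where
    prefix : ∀ s t → SkipPlay (s ++ t) → Even (length s) → SkipPlay s
    prefix []              _ _        _   = silent
    prefix (_ ∷ [])        _ _        2∣1 with () ← ∣1⇒≡1 2∣1
    prefix (_ ∷ _ ∷ [])    _ answered _   = answered
    prefix (_ ∷ _ ∷ _ ∷ _) _ ()       _

    determined : ∀ s t x y x' y' → SkipPlay (s ++ x ∷ y ∷ []) → SkipPlay (t ++ x' ∷ y' ∷ []) →
      GameData._≋_ 𝟘⊸com (s ∷ʳ x) (t ∷ʳ x') →
      GameData._≋_ 𝟘⊸com (s ++ x ∷ y ∷ []) (t ++ x' ∷ y' ∷ [])
    determined s t x y x' y' p p' _
      rewrite nonempty-SkipPlay s (x ∷ y ∷ []) p (λ ())
            | nonempty-SkipPlay t (x' ∷ y' ∷ []) p' (λ ()) = qa⊸-refl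

  module _ {ℓ ℓ' : Carrier} (N : NatTrans ℓ ℓ') where
    open NatTrans N

    private
      module Pre  = Interaction (TL ℓ (gd 𝟘)) (TL ℓ (gd com)) (TL ℓ' (gd com))
      module Post = Interaction (TL ℓ (gd 𝟘)) (TL ℓ' (gd 𝟘)) (TL ℓ' (gd com))

    Ω-after-η-silent : ¬ compose (TL ℓ (gd 𝟘)) (TL ℓ' (gd 𝟘)) (TL ℓ' (gd com))
                               (σ (η 𝟘)) (σ Ω) qa⊸
    Ω-after-η-silent qa∈η∘Ω with Post.compose-restR {ρ = σ (η 𝟘)} {τ = σ Ω} qa∈η∘Ω
    ... | .[] , refl , ()

    η-com-plays-domain-q : ∃ λ s → σ (η com) s × ∃ λ z → inj₁ (z , q) ∈ s
    η-com-plays-domain-q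
      with proj₂ (natural 𝟘 com skip qa⊸)
                 (inj₂ (inj₂ q) ∷ inj₂ (inj₂ a) ∷ [] , refl , []∈σ (η 𝟘) , answered)
    ... | s , s↾XZ≡qa , s↾XY∈skip , s↾YZ∈η with s Pre.↾XY in s↾XY≡u | s↾XY∈skip
    ...   | .[]  | silent   =
            ⊥-elim (Ω-after-η-silent (proj₁ (natural 𝟘 com Ω qa⊸)
                                             (s , s↾XZ≡qa , s↾XY≡u , s↾YZ∈η)))
    ...   | .qa⊸ | answered =
            s Pre.↾YZ , s↾YZ∈η , Pre.∈-↾XY-right s (subst (inj₂ q ∈_) (sym s↾XY≡u) (here refl))

mainTheorem3 : ∀ {c r} (L : BoundedJoinSemilattice c r)
    (ℓ ℓ' : BoundedJoinSemilattice.Carrier L) →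
    ¬ (Games._≤_ L ℓ ℓ') → ¬ Games.NatTrans L ℓ ℓ'
mainTheorem3 L ℓ ℓ' ℓ≰ℓ' N with η-com-plays-domain-q L N
... | s , s∈η , _ , q∈s = ℓ≰ℓ' (≤-cong L (identityˡ ℓ) (identityˡ ℓ') ⊥∨ℓ≤⊥∨ℓ')
  where
  open BoundedJoinSemilattice L using (⊥; _∨_; identityˡ)
  open Games L

  ⊥∨ℓ≤⊥∨ℓ' : (⊥ ∨ ℓ) ≤ (⊥ ∨ ℓ')
  ⊥∨ℓ≤⊥∨ℓ' = lev-initial≤lev-copy L (TL ℓ (Game.gd (com L))) (TL ℓ' (Game.gd (com L)))
    (proj₁ (proj₁ (Strategy.plays (NatTrans.η N (com L)) s s∈η))) q∈s refl
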